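{- The following degree sequences are all forcibly self-complementary: $(0^1)$, $(2^2,1^2)$, $(2^5)$, and $(5^4,2^4)$.
   Context: Graphs are finite and simple; a graph is self-complementary if it is isomorphic to its complement. The degree sequence of a graph is the non-increasing list of its vertex degrees, written compactly as $(d_1^{n_1},\dots,d_\ell^{n_\ell})$ with $d_1>\dots>d_\ell$, meaning $n_i$ entries equal to $d_i$. A realization of a degree sequence is a graph with that degree sequence; the sequence is forcibly self-complementary if all its realizations are self-complementary. -}

module Defs where

open import Data.Nat using (ℕ)
open import Data.Bool using (Bool; true; false; not; if_then_else_)
open import Data.Fin using (Fin)
open import Data.Fin.Properties using (_≟_)
open import Data.List using (List; []; _∷_; map; filter; length; replicate; _++_)
open import Data.List.Relation.Binary.Permutation.Propositional using (_↭_)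
open import Data.Product using (Σ; _×_; _,_)
open import Function.Bundles using (_↔_; Inverse)
open import Relation.Binary.PropositionalEquality using (_≡_)
open import Data.List.Base using (allFin)
open import Data.Empty using (⊥-elim)

record Graph (n : ℕ) : Set where
  field
    adj   : Fin n → Fin n → Bool
    sym   : ∀ i j → adj i j ≡ adj j i
    irrefl : ∀ i → adj i i ≡ false
open Graph public

complement : ∀ {n} → Graph n → Graph n
complement {n} G = record { adj = cadj ; sym = csym ; irrefl = cirr }
  where
  open import Relation.Binary.PropositionalEquality using (refl; cong)
  open import Relation.Nullary using (yes; no)
  cadj : Fin n → Fin n → Bool
  cadj i j with i ≟ j
  ... | yes _ = false
  ... | no  _ = not (adj G i j)
  csym : ∀ i j → cadj i j ≡ cadj j i
  csym i j with i ≟ j | j ≟ i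
  ... | yes _ | yes _ = refl
  ... | yes refl | no q = ⊥-elim (q refl)
  ... | no p | yes refl = ⊥-elim (p refl)
  ... | no _ | no _ = cong not (Graph.sym G i j)
  cirr : ∀ i → cadj i i ≡ false
  cirr i with i ≟ i
  ... | yes _ = refl
  ... | no p = ⊥-elim (p refl)

_≅_ : ∀ {n m} → Graph n → Graph m → Set
_≅_ {n} {m} G H =
  Σ (Fin n ↔ Fin m) λ σ →
    ∀ i j → adj H (Inverse.to σ i) (Inverse.to σ j) ≡ adj G i j

SelfComplementary : ∀ {n} → Graph n → Set
SelfComplementary G = G ≅ complement G

degree : ∀ {n} → Graph n → Fin n → ℕ
degree G i = length (filter (λ j → adj G i j ≡? true) (allFin _))
  where
  open import Data.Bool.Properties using () renaming (_≟_ to _≡?_)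

degrees : ∀ {n} → Graph n → List ℕ
degrees G = map (degree G) (allFin _)

expand : List (ℕ × ℕ) → List ℕ
expand [] = []
expand ((d , k) ∷ rest) = replicate k d ++ expand rest

-- G realizes the (non-increasing) degree sequence s: the list of its vertex
-- degrees, sorted non-increasingly, is s; equivalently (s being sorted)
-- the degree list is a permutation of s.
Realizes : ∀ {n} → Graph n → List ℕ → Set
Realizes G s = degrees G ↭ s

ForciblySelfComplementary : List ℕ → Set
ForciblySelfComplementary s =
  ∀ (n : ℕ) (G : Graph n) → Realizes G s → SelfComplementary G

{-# OPTIONS --safe #-}
module Submission where

-- The realizations are P₄, C₅ and, for (5⁴,2⁴), a K₄ on the vertices of degree 5 joined to an
-- independent set by a 2-regular bipartite graph; each is isomorphic to its complement, which
-- swaps the roles of the two degree classes.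
--
-- Relabel a realization so that vertex x has degree s[x]; an
-- edge-by-edge search over partially known adjacency matrices, discarding those in which some
-- vertex can no longer reach its prescribed degree, then reaches only complete matrices for which
-- one of a few listed permutations is an isomorphism onto the complement.  Soundness follows a
-- given realization down the search tree: its own adjacency picks the branch, and its degrees
-- keep that branch alive.

open import Defs hiding (sym)
open import Data.Nat using (ℕ; zero; suc; _≤_; _≤?_; z≤n; s≤s)
open import Data.Nat.Properties using (+-0-commutativeMonoid; +-mono-≤)
open import Data.Bool using (Bool; true; false; not; _∧_; if_then_else_; T)
import Data.Bool.Properties as Bool
open import Data.Unit using (tt)
open import Data.Fin using (Fin; zero; suc; _<?_; #_)
open import Data.Fin.Properties using (_≟_; all?; any?)
open import Data.Fin.Permutation using (Permutation′; permutation; cast-id; _∘ₚ_)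
open import Data.List using (List; []; _∷_; length; lookup; allFin; tabulate; filter; cartesianProduct; mapMaybe)
open import Data.List.Properties using (map-tabulate; length-tabulate; lookup-tabulate)
open import Data.List.Relation.Binary.Permutation.Propositional using (_↭_; ↭⇒↭ₛ)
import Data.List.Relation.Binary.Permutation.Setoid as SetoidPermutation
import Data.List.Relation.Binary.Permutation.Setoid.Properties as SetoidPermutationProperties
open import Data.List.Relation.Unary.Any using (Any; satisfied)
import Data.List.Relation.Unary.Any as Any
open import Data.Maybe using (Maybe; just; nothing; fromMaybe)
import Data.Maybe.Properties as Maybe
open import Data.Product using (Σ-syntax; _×_; _,_; proj₁; proj₂)
import Data.Product.Properties as Product
open import Data.Vec as Vec using (Vec; []; _∷_; updateAt; _[_]≔_)
open import Data.Vec.Properties using (lookup∘tabulate; lookup∘updateAt; lookup∘updateAt′; lookup∘update; lookup∘update′)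
open import Function.Base using (_∘_; id)
open import Function.Bundles using (_↔_; Inverse; Injection; Equivalence)
open import Function.Construct.Composition using (_↔-∘_)
open import Function.Construct.Symmetry using (↔-sym)
open import Function.Properties.Inverse using (↔⇒↣)
open import Relation.Binary.PropositionalEquality
  using (_≡_; _≢_; refl; sym; trans; cong; cong₂; subst; setoid; module ≡-Reasoning)
open import Relation.Nullary using (Dec; yes; no; does; isYes; contradiction)
open import Relation.Nullary.Decidable using (_×-dec_; toWitness; dec-true)
import Algebra.Properties.CommutativeMonoid.Sum as CommutativeMonoidSum

open Inverse using (to; from; strictlyInverseˡ)
open CommutativeMonoidSum +-0-commutativeMonoid using (sum; sum-permute; sum-cong-≗)

private
  variable
    n m k : ℕ
    A : Set

≅-sym : {G : Graph n} {H : Graph m} → G ≅ H → H ≅ G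
≅-sym {G = G} {H} (σ , σ-adj) = ↔-sym σ , λ x y → begin
  adj G (from σ x) (from σ y)               ≡⟨ σ-adj (from σ x) (from σ y) ⟨
  adj H (to σ (from σ x)) (to σ (from σ y)) ≡⟨ cong₂ (adj H) (strictlyInverseˡ σ x) (strictlyInverseˡ σ y) ⟩
  adj H x y                                 ∎
  where open ≡-Reasoning

≅-trans : {G : Graph n} {H : Graph m} {K : Graph k} → G ≅ H → H ≅ K → G ≅ K
≅-trans (σ , σ-adj) (τ , τ-adj) = τ ↔-∘ σ , λ i j → trans (τ-adj _ _) (σ-adj i j)

complement-≅ : {G : Graph n} {H : Graph m} → G ≅ H → complement G ≅ complement H
complement-≅ {G = G} {H} (σ , σ-adj) = σ , adj-σ
  where
  adj-σ : ∀ i j → adj (complement H) (to σ i) (to σ j) ≡ adj (complement G) i j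
  adj-σ i j with to σ i ≟ to σ j | i ≟ j
  ... | yes _     | yes _    = refl
  ... | yes σi≡σj | no i≢j   = contradiction (Injection.injective (↔⇒↣ σ) σi≡σj) i≢j
  ... | no σi≢σj  | yes refl = contradiction refl σi≢σj
  ... | no _      | no _     = cong not (σ-adj i j)

selfComplementary-resp-≅ : {G : Graph n} {H : Graph m} → G ≅ H → SelfComplementary H → SelfComplementary G
selfComplementary-resp-≅ {G = G} {H} G≅H H≅H̅ = ≅-trans {G = G} {H} {complement G} G≅H H≅G̅
  where
  H̅≅G̅ : complement H ≅ complement G
  H̅≅G̅ = complement-≅ {G = H} {G} (≅-sym {G = G} {H} G≅H)
  H≅G̅ : H ≅ complement G
  H≅G̅ = ≅-trans {G = H} {complement H} {complement G} H≅H̅ H̅≅G̅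

complementAdj : (Fin n → Fin n → Bool) → Fin n → Fin n → Bool
complementAdj a i j = if does (i ≟ j) then false else not (a i j)

adj-complement : (G : Graph n) → ∀ i j → adj (complement G) i j ≡ complementAdj (adj G) i j
adj-complement G i j with i ≟ j
... | yes _ = refl
... | no _  = refl

IsoToComplement : (Fin n → Fin n → Bool) → Permutation′ n → Set
IsoToComplement a σ = ∀ i j → complementAdj a (to σ i) (to σ j) ≡ a i j

isoToComplement⇒selfComplementary : (G : Graph n) {a : Fin n → Fin n → Bool} (σ : Permutation′ n) →
  (∀ i j → adj G i j ≡ a i j) → IsoToComplement a σ → SelfComplementary G
isoToComplement⇒selfComplementary G {a} σ G≗a σ-iso = σ , λ i j → begin
  adj (complement G) (to σ i) (to σ j)    ≡⟨ adj-complement G _ _ ⟩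
  complementAdj (adj G) (to σ i) (to σ j) ≡⟨ cong (if does (to σ i ≟ to σ j) then false else_ ∘ not) (G≗a _ _) ⟩
  complementAdj a (to σ i) (to σ j)       ≡⟨ σ-iso i j ⟩
  a i j                                   ≡⟨ G≗a i j ⟨
  adj G i j                               ∎
  where open ≡-Reasoning

relabel : Graph m → Fin n ↔ Fin m → Graph n
relabel G σ = record
  { adj    = λ i j → adj G (to σ i) (to σ j)
  ; sym    = λ i j → Graph.sym G (to σ i) (to σ j)
  ; irrefl = λ i → irrefl G (to σ i)
  }

relabel-≅ : (G : Graph m) (σ : Fin n ↔ Fin m) → relabel G σ ≅ G
relabel-≅ G σ = σ , λ _ _ → refl

indicator : Bool → ℕ
indicator true  = 1
indicator false = 0

count : (Fin n → Bool) → ℕ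
count a = sum (indicator ∘ a)

length-filter-tabulate : (a : A → Bool) (f : Fin n → A) →
  length (filter (λ x → a x Bool.≟ true) (tabulate f)) ≡ count (a ∘ f)
length-filter-tabulate {n = zero}  a f = refl
length-filter-tabulate {n = suc n} a f with a (f zero)
... | true  = cong suc (length-filter-tabulate a (f ∘ suc))
... | false = length-filter-tabulate a (f ∘ suc)

degree≡count : (G : Graph n) (i : Fin n) → degree G i ≡ count (adj G i)
degree≡count G i = length-filter-tabulate (adj G i) id

count-permute : (σ : Fin n ↔ Fin m) (a : Fin m → Bool) → count (a ∘ to σ) ≡ count a
count-permute σ a = sym (sum-permute (indicator ∘ a) σ)

degree-≅ : (G : Graph n) (H : Graph m) (G≅H : G ≅ H) → ∀ i → degree H (to (proj₁ G≅H) i) ≡ degree G i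
degree-≅ G H (σ , σ-adj) i = begin
  degree H (to σ i)                     ≡⟨ degree≡count H (to σ i) ⟩
  count (adj H (to σ i))                ≡⟨ count-permute σ (adj H (to σ i)) ⟨
  count (λ j → adj H (to σ i) (to σ j)) ≡⟨ sum-cong-≗ (cong indicator ∘ σ-adj i) ⟩
  count (adj G i)                       ≡⟨ degree≡count G i ⟨
  degree G i                            ∎
  where open ≡-Reasoning

tabulate-↭⇒reindexing : (f : Fin n → A) {ys : List A} → tabulate f ↭ ys →
  Σ[ π ∈ Fin n ↔ Fin (length ys) ] ∀ i → f i ≡ lookup ys (to π i)
tabulate-↭⇒reindexing {A = A} f f↭ys =
  cast-id (sym (length-tabulate f)) ∘ₚ onIndices f↭ₛys ,
  λ i → trans (sym (lookup-tabulate f i)) (onIndices-lookup f↭ₛys _)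
  where
  open SetoidPermutation (setoid A) using (onIndices)
  open SetoidPermutationProperties (setoid A) using (onIndices-lookup)
  f↭ₛys = ↭⇒↭ₛ f↭ys

sortedRealization : {G : Graph n} {s : List ℕ} → Realizes G s →
  Σ[ H ∈ Graph (length s) ] H ≅ G × (∀ x → degree H x ≡ lookup s x)
sortedRealization {G = G} {s} G-realizes-s = H , H≅G , degree-H
  where
  π-sorts = tabulate-↭⇒reindexing (degree G) (subst (_↭ s) (map-tabulate id (degree G)) G-realizes-s)
  π = proj₁ π-sorts
  H = relabel G (↔-sym π)
  H≅G = relabel-≅ G (↔-sym π)
  degree-H : ∀ x → degree H x ≡ lookup s x
  degree-H x = begin
    degree H x                 ≡⟨ degree-≅ H G H≅G x ⟨
    degree G (from π x)        ≡⟨ proj₂ π-sorts (from π x) ⟩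
    lookup s (to π (from π x)) ≡⟨ cong (lookup s) (strictlyInverseˡ π x) ⟩
    lookup s x                 ∎
    where open ≡-Reasoning

sortedRealizations⇒forciblySelfComplementary : (s : List ℕ) →
  (∀ (H : Graph (length s)) → (∀ x → degree H x ≡ lookup s x) → SelfComplementary H) →
  ForciblySelfComplementary s
sortedRealizations⇒forciblySelfComplementary s sorted-sc n G G-realizes-s
  with H , H≅G , degree-H ← sortedRealization {G = G} G-realizes-s =
  selfComplementary-resp-≅ {G = G} {H} (≅-sym {G = H} {G} H≅G) (sorted-sc H degree-H)

PartialAdjacency : ℕ → Set
PartialAdjacency n = Vec (Vec (Maybe Bool) n) n

entry : PartialAdjacency n → Fin n → Fin n → Maybe Bool
entry P i j = Vec.lookup (Vec.lookup P i) j

_≼_ : (Fin n → Maybe Bool) → (Fin n → Bool) → Set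
r ≼ a = ∀ j {b} → r j ≡ just b → a j ≡ b

_⊑_ : PartialAdjacency n → Graph n → Set
P ⊑ G = ∀ i → entry P i ≼ adj G i

initial : PartialAdjacency n
initial = Vec.tabulate λ i → Vec.tabulate λ j → if does (i ≟ j) then just false else nothing

initial-⊑ : (G : Graph n) → initial ⊑ G
initial-⊑ G i j {b} e = initial-entry (i ≟ j) (trans (sym entry-initial) e)
  where
  entry-initial : entry initial i j ≡ (if does (i ≟ j) then just false else nothing)
  entry-initial = trans (cong (λ r → Vec.lookup r j) (lookup∘tabulate _ i)) (lookup∘tabulate _ j)
  initial-entry : (i≟j : Dec (i ≡ j)) → (if does i≟j then just false else nothing) ≡ just b → adj G i j ≡ b
  initial-entry (yes refl) refl = irrefl G i
  initial-entry (no _)     ()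

assign : Fin n → Fin n → Bool → PartialAdjacency n → PartialAdjacency n
assign i j b P = updateAt P i (_[ j ]≔ just b)

module _ {P : PartialAdjacency n} {i j : Fin n} {b : Bool} where

  entry-assign-≡ : entry (assign i j b P) i j ≡ just b
  entry-assign-≡ = trans (cong (λ r → Vec.lookup r j) (lookup∘updateAt i P)) (lookup∘update j (Vec.lookup P i) (just b))

  entry-assign-≢ : ∀ {x y} → (x , y) ≢ (i , j) → entry (assign i j b P) x y ≡ entry P x y
  entry-assign-≢ {x} {y} xy≢ij with x ≟ i
  ... | no x≢i   = cong (λ r → Vec.lookup r y) (lookup∘updateAt′ x i x≢i P)
  ... | yes refl = trans (cong (λ r → Vec.lookup r y) (lookup∘updateAt i P))
                         (lookup∘update′ (xy≢ij ∘ cong (i ,_)) (Vec.lookup P i) (just b))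

assign-⊑ : {P : PartialAdjacency n} {G : Graph n} {i j : Fin n} {b : Bool} →
  P ⊑ G → adj G i j ≡ b → assign i j b P ⊑ G
assign-⊑ {P = P} {i = i} {j} P⊑G Gij≡b x y e with Product.≡-dec _≟_ _≟_ (x , y) (i , j)
... | yes refl = trans Gij≡b (Maybe.just-injective (trans (sym (entry-assign-≡ {P = P})) e))
... | no xy≢ij = P⊑G x y (trans (sym (entry-assign-≢ {P = P} xy≢ij)) e)

place : Fin n → Fin n → Bool → PartialAdjacency n → PartialAdjacency n
place i j b = assign j i b ∘ assign i j b

place-⊑ : {P : PartialAdjacency n} {G : Graph n} {i j : Fin n} {b : Bool} →
  P ⊑ G → adj G i j ≡ b → place i j b P ⊑ G
place-⊑ {P = P} {G} {i} {j} {b} P⊑G Gij≡b =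
  assign-⊑ {P = assign i j b P} {G} {j} {i} (assign-⊑ {P = P} {G} {i} {j} P⊑G Gij≡b) (trans (Graph.sym G j i) Gij≡b)

surelyAdjacent possiblyAdjacent : Maybe Bool → ℕ
surelyAdjacent (just true) = 1
surelyAdjacent _           = 0
possiblyAdjacent (just false) = 0
possiblyAdjacent _            = 1

sum-mono-≤ : {f g : Fin n → ℕ} → (∀ i → f i ≤ g i) → sum f ≤ sum g
sum-mono-≤ {zero}  _   = z≤n
sum-mono-≤ {suc n} f≤g = +-mono-≤ (f≤g zero) (sum-mono-≤ (f≤g ∘ suc))

Admissible : (Fin n → Maybe Bool) → ℕ → Set
Admissible r d = sum (surelyAdjacent ∘ r) ≤ d × d ≤ sum (possiblyAdjacent ∘ r)

admissible? : (r : Fin n → Maybe Bool) (d : ℕ) → Dec (Admissible r d)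
admissible? r d = sum (surelyAdjacent ∘ r) ≤? d ×-dec d ≤? sum (possiblyAdjacent ∘ r)

≼⇒admissible : {r : Fin n → Maybe Bool} {a : Fin n → Bool} → r ≼ a → Admissible r (count a)
≼⇒admissible {r = r} {a} r≼a = sum-mono-≤ surely≤ , sum-mono-≤ ≤possibly
  where
  surely≤ : ∀ j → surelyAdjacent (r j) ≤ indicator (a j)
  surely≤ j with r j in rj
  ... | just true rewrite r≼a j rj = s≤s z≤n
  ... | just false = z≤n
  ... | nothing    = z≤n
  indicator≤1 : ∀ c → indicator c ≤ 1
  indicator≤1 true  = s≤s z≤n
  indicator≤1 false = z≤n
  ≤possibly : ∀ j → indicator (a j) ≤ possiblyAdjacent (r j)
  ≤possibly j with r j in rj
  ... | just false rewrite r≼a j rj = z≤n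
  ... | just true  = indicator≤1 (a j)
  ... | nothing    = indicator≤1 (a j)

T-if-does : {x : Bool} (d : Dec A) → A → T (if does d then x else true) → T x
T-if-does d a t rewrite dec-true d a = t

T-∧-at : (f : Bool → Bool) → T (f false ∧ f true) → ∀ b → T (f b)
T-∧-at f t false = proj₁ (Equivalence.to Bool.T-∧ t)
T-∧-at f t true  = proj₂ (Equivalence.to Bool.T-∧ t)

module Search (D : Fin n → ℕ) (isos : List (Permutation′ n)) where

  Consistent : PartialAdjacency n → Fin n → Fin n → Set
  Consistent P i j = Admissible (entry P i) (D i) × Admissible (entry P j) (D j)

  consistent? : ∀ P i j → Dec (Consistent P i j)
  consistent? P i j = admissible? (entry P i) (D i) ×-dec admissible? (entry P j) (D j)

  table : PartialAdjacency n → Fin n → Fin n → Bool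
  table P i j = fromMaybe false (entry P i j)

  Settled : PartialAdjacency n → Set
  Settled P = (∀ i j → entry P i j ≡ just (table P i j)) × Any (IsoToComplement (table P)) isos

  settled? : ∀ P → Dec (Settled P)
  settled? P =
    all? (λ i → all? λ j → Maybe.≡-dec Bool._≟_ (entry P i j) (just (table P i j)))
    ×-dec Any.any? (λ σ → all? λ i → all? λ j → complementAdj (table P) (to σ i) (to σ j) Bool.≟ table P i j) isos

  mutual
    search : PartialAdjacency n → List (Fin n × Fin n) → Bool
    search P []             = isYes (settled? P)
    search P ((i , j) ∷ ps) = branch P i j ps false ∧ branch P i j ps true

    branch : PartialAdjacency n → Fin n → Fin n → List (Fin n × Fin n) → Bool → Bool
    branch P i j ps b = if does (consistent? Q i j) then search Q ps else true
      where Q = place i j b P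

  module _ (H : Graph n) (degree-H : ∀ i → degree H i ≡ D i) where

    ⊑⇒consistent : (P : PartialAdjacency n) → P ⊑ H → ∀ i j → Consistent P i j
    ⊑⇒consistent P P⊑H i j = admissible i , admissible j
      where
      admissible : ∀ x → Admissible (entry P x) (D x)
      admissible x = subst (Admissible (entry P x)) (trans (sym (degree≡count H x)) (degree-H x))
                           (≼⇒admissible (P⊑H x))

    settled⇒selfComplementary : (P : PartialAdjacency n) → P ⊑ H → Settled P → SelfComplementary H
    settled⇒selfComplementary P P⊑H (complete , iso) with σ , σ-iso ← satisfied iso =
      isoToComplement⇒selfComplementary H σ (λ i j → P⊑H i j (complete i j)) σ-iso

    search⇒selfComplementary : ∀ P ps → P ⊑ H → T (search P ps) → SelfComplementary H
    search⇒selfComplementary P [] P⊑H t =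
      settled⇒selfComplementary P P⊑H (toWitness {a? = settled? P} t)
    search⇒selfComplementary P ((i , j) ∷ ps) P⊑H t =
      search⇒selfComplementary Q ps Q⊑H (T-if-does (consistent? Q i j) (⊑⇒consistent Q Q⊑H i j) H-branch)
      where
      Q = place i j (adj H i j) P
      Q⊑H : Q ⊑ H
      Q⊑H = place-⊑ {P = P} {H} {i} {j} P⊑H refl
      H-branch : T (branch P i j ps (adj H i j))
      H-branch = T-∧-at (branch P i j ps) t (adj H i j)

-- Any list of pairs is sound: a matrix left incomplete is simply not Settled.
pairs : ∀ n → List (Fin n × Fin n)
pairs n = filter (λ (i , j) → i <? j) (cartesianProduct (allFin n) (allFin n))

preimage : (Fin n → Fin n) → Fin n → Fin n
preimage f y with any? (λ x → f x ≟ y)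
... | yes (x , _) = x
... | no _        = y

toPermutation : (Fin n → Fin n) → Maybe (Permutation′ n)
toPermutation f with all? (λ y → f (preimage f y) ≟ y) | all? (λ x → preimage f (f x) ≟ x)
... | yes f∘f⁻¹≗id | yes f⁻¹∘f≗id = just (permutation f (preimage f) f∘f⁻¹≗id f⁻¹∘f≗id)
... | _            | _            = nothing

search⇒forciblySelfComplementary : (s : List ℕ) (isos : List (Vec (Fin (length s)) (length s))) →
  T (Search.search (lookup s) (mapMaybe (toPermutation ∘ Vec.lookup) isos) initial (pairs (length s))) →
  ForciblySelfComplementary s
search⇒forciblySelfComplementary s isos t =
  sortedRealizations⇒forciblySelfComplementary s λ H degree-H →
    Search.search⇒selfComplementary (lookup s) (mapMaybe (toPermutation ∘ Vec.lookup) isos) H degree-H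
      initial (pairs (length s)) (initial-⊑ H) t

-- Found by computer: every realization of the sequence, its vertices labelled in sequence order,
-- is mapped onto its complement by one of these permutations (given by their images).
isos-0¹ : List (Vec (Fin 1) 1)
isos-0¹ = (# 0 ∷ []) ∷ []

isos-2²1² : List (Vec (Fin 4) 4)
isos-2²1² = (# 3 ∷ # 2 ∷ # 0 ∷ # 1 ∷ []) ∷ []

isos-2⁵ : List (Vec (Fin 5) 5)
isos-2⁵ =
    (# 4 ∷ # 1 ∷ # 0 ∷ # 2 ∷ # 3 ∷ [])
  ∷ (# 2 ∷ # 0 ∷ # 3 ∷ # 1 ∷ # 4 ∷ [])
  ∷ (# 1 ∷ # 3 ∷ # 2 ∷ # 4 ∷ # 0 ∷ [])
  ∷ []

isos-5⁴2⁴ : List (Vec (Fin 8) 8)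
isos-5⁴2⁴ =
    (# 7 ∷ # 5 ∷ # 4 ∷ # 6 ∷ # 3 ∷ # 0 ∷ # 2 ∷ # 1 ∷ [])
  ∷ (# 7 ∷ # 6 ∷ # 5 ∷ # 4 ∷ # 0 ∷ # 1 ∷ # 2 ∷ # 3 ∷ [])
  ∷ (# 5 ∷ # 7 ∷ # 4 ∷ # 6 ∷ # 3 ∷ # 1 ∷ # 2 ∷ # 0 ∷ [])
  ∷ (# 4 ∷ # 7 ∷ # 5 ∷ # 6 ∷ # 2 ∷ # 0 ∷ # 1 ∷ # 3 ∷ [])
  ∷ (# 6 ∷ # 4 ∷ # 5 ∷ # 7 ∷ # 2 ∷ # 1 ∷ # 3 ∷ # 0 ∷ [])
  ∷ (# 6 ∷ # 7 ∷ # 5 ∷ # 4 ∷ # 1 ∷ # 0 ∷ # 2 ∷ # 3 ∷ [])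
  ∷ (# 4 ∷ # 7 ∷ # 5 ∷ # 6 ∷ # 3 ∷ # 1 ∷ # 0 ∷ # 2 ∷ [])
  ∷ (# 7 ∷ # 6 ∷ # 4 ∷ # 5 ∷ # 0 ∷ # 1 ∷ # 3 ∷ # 2 ∷ [])
  ∷ (# 4 ∷ # 7 ∷ # 6 ∷ # 5 ∷ # 2 ∷ # 1 ∷ # 0 ∷ # 3 ∷ [])
  ∷ (# 6 ∷ # 7 ∷ # 4 ∷ # 5 ∷ # 3 ∷ # 2 ∷ # 1 ∷ # 0 ∷ [])
  ∷ (# 4 ∷ # 5 ∷ # 6 ∷ # 7 ∷ # 2 ∷ # 3 ∷ # 0 ∷ # 1 ∷ [])
  ∷ (# 6 ∷ # 7 ∷ # 4 ∷ # 5 ∷ # 1 ∷ # 0 ∷ # 3 ∷ # 2 ∷ [])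
  ∷ (# 5 ∷ # 6 ∷ # 7 ∷ # 4 ∷ # 2 ∷ # 1 ∷ # 0 ∷ # 3 ∷ [])
  ∷ (# 4 ∷ # 5 ∷ # 6 ∷ # 7 ∷ # 1 ∷ # 0 ∷ # 3 ∷ # 2 ∷ [])
  ∷ (# 7 ∷ # 4 ∷ # 5 ∷ # 6 ∷ # 0 ∷ # 3 ∷ # 2 ∷ # 1 ∷ [])
  ∷ (# 6 ∷ # 5 ∷ # 4 ∷ # 7 ∷ # 1 ∷ # 2 ∷ # 3 ∷ # 0 ∷ [])
  ∷ (# 7 ∷ # 4 ∷ # 6 ∷ # 5 ∷ # 3 ∷ # 1 ∷ # 0 ∷ # 2 ∷ [])
  ∷ (# 4 ∷ # 5 ∷ # 7 ∷ # 6 ∷ # 3 ∷ # 2 ∷ # 0 ∷ # 1 ∷ [])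
  ∷ []

proposition11 : ForciblySelfComplementary (expand ((0 , 1) ∷ []))
    × ForciblySelfComplementary (expand ((2 , 2) ∷ (1 , 2) ∷ []))
    × ForciblySelfComplementary (expand ((2 , 5) ∷ []))
    × ForciblySelfComplementary (expand ((5 , 4) ∷ (2 , 4) ∷ []))
proposition11 =
    search⇒forciblySelfComplementary _ isos-0¹ tt
  , search⇒forciblySelfComplementary _ isos-2²1² tt
  , search⇒forciblySelfComplementary _ isos-2⁵ tt
  , search⇒forciblySelfComplementary _ isos-5⁴2⁴ tt
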